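{- For any $m$-colored poset $P$ there is a bijection \[ \mathcal{E}^{(m)}(P; \mathbb{P}_m^{\pm} + (\mathbb{P}_m^{\pm})') \longleftrightarrow \coprod_{I \in \mathcal{I}(P)} \mathcal{E}^{(m)}(I; \mathbb{P}_m^{\pm}) \times \mathcal{E}^{(m)}(P\setminus I; (\mathbb{P}_m^{\pm})'),\] where $\mathcal{I}(P)$ is the set of order ideals of $P$.
   Context: Fix $m\ge1$, $\omega$ a primitive $m$th root of unity. For a totally ordered countable set $S=\{s_1<s_2<\cdots\}$, $S_m$ consists of $\omega^js$ ordered $s_1<\omega s_1<\cdots<\omega^{m-1}s_1<s_2<\cdots$ with color $\varepsilon(\omega^js)=j$, and $S_m^{\pm}=S_m\cup(-S_m)$ ordered $-s_1<s_1<-\omega s_1<\omega s_1<\cdots<-\omega^{m-1}s_1<\omega^{m-1}s_1<-s_2<s_2<\cdots$ with $\varepsilon(\pm\omega^js)=j$; $s\le^+t$ means $s<t$ or $s=t\in S_m$, $s\le^-t$ means $s<t$ or $s=t\in-S_m$. $\mathbb{P}_m^{\pm}$, $(\mathbb{P}_m^{\pm})'$ and $\mathbb{P}_m^{\pm}+(\mathbb{P}_m^{\pm})'$ are $S_m^{\pm}$ for $S=\{1<2<\cdots\}$, $S=\{1'<2'<\cdots\}$, and $S=\{1<2<\cdots<1'<2'<\cdots\}$ respectively; $\mathbb{P}_m$ is $S_m$ for $S=\{1<2<\cdots\}$. An $m$-colored poset is a finite subset of $\mathbb{P}_m$ with distinct underlying integers and a partial order $<_P$; an order ideal is a subset $I$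 with $x\in I$, $y<_Px\Rightarrow y\in I$, and $I$, $P\setminus I$ carry induced orders. An $m$-colored enriched $P$-partition into $S_m^{\pm}$ is $f:P\to S_m^{\pm}$ with (1) $\varepsilon(i)=\varepsilon(f(i))$, (2) $f(i)\le^+f(j)$ if $i<_Pj$ and $i<j$ in $\mathbb{P}_m$, (3) $f(i)\le^-f(j)$ if $i<_Pj$ and $i>j$ in $\mathbb{P}_m$; $\mathcal{E}^{(m)}(P;S_m^{\pm})$ is the set of these. -}

module Defs where

open import Data.Nat using (ℕ; zero; suc; _<ᵇ_; _≡ᵇ_)
open import Data.Bool using (Bool; true; false; _∧_; _∨_; not; if_then_else_; T)
open import Data.Fin using (Fin; zero; suc; toℕ)
open import Data.Vec using (Vec; []; _∷_; lookup; map)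
open import Data.Sum using (_⊎_; inj₁; inj₂)
open import Data.Product using (_×_; _,_; proj₁; proj₂; Σ)
open import Relation.Binary.PropositionalEquality using (_≡_)
open import Relation.Nullary using (¬_)

_⇒ᵇ_ : Bool → Bool → Bool
a ⇒ᵇ b = not a ∨ b

allF : {k : ℕ} → (Fin k → Bool) → Bool
allF {zero}  p = true
allF {suc k} p = p zero ∧ allF (λ i → p (suc i))

eqFin : {m : ℕ} → Fin m → Fin m → Bool
eqFin a b = toℕ a ≡ᵇ toℕ b

ltFin : {m : ℕ} → Fin m → Fin m → Bool
ltFin a b = toℕ a <ᵇ toℕ b

-- The colored chain ℙ_m.  The element ω^j s (s ∈ {1,2,...}) is encoded
-- as the pair (s - 1 , j) : ℕ × Fin m.  Order: s₁ < ω s₁ < ... < s₂ < ...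

PmElt : ℕ → Set
PmElt m = ℕ × Fin m

_<Pm_ : {m : ℕ} → PmElt m → PmElt m → Bool
(s , j) <Pm (t , k) = (s <ᵇ t) ∨ ((s ≡ᵇ t) ∧ ltFin j k)

record ColoredPoset (m : ℕ) : Set where
  field
    size     : ℕ
    label    : Fin size → PmElt m
    lt       : Fin size → Fin size → Bool
    distinct : ∀ i j → proj₁ (label i) ≡ proj₁ (label j) → i ≡ j
    irrefl   : ∀ i → ¬ T (lt i i)
    trans    : ∀ i j k → T (lt i j) → T (lt j k) → T (lt i k)

-- Raw data of a colored poset (what enriched P-partitions depend on).
record RawPoset (m : ℕ) : Set where
  field
    size  : ℕ
    label : Fin size → PmElt m
    lt    : Fin size → Fin size → Bool

raw : {m : ℕ} → ColoredPoset m → RawPoset m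
raw P = record { size = ColoredPoset.size P ; label = ColoredPoset.label P ; lt = ColoredPoset.lt P }

Subset : ℕ → Set
Subset k = Vec Bool k

count : {k : ℕ} → Subset k → ℕ
count []          = zero
count (true ∷ I)  = suc (count I)
count (false ∷ I) = count I

emb : {k : ℕ} → (I : Subset k) → Fin (count I) → Fin k
emb (true ∷ I)  zero    = zero
emb (true ∷ I)  (suc i) = suc (emb I i)
emb (false ∷ I) i       = suc (emb I i)

complement : {k : ℕ} → Subset k → Subset k
complement = map not

isIdeal : {m : ℕ} → (P : RawPoset m) → Subset (RawPoset.size P) → Bool
isIdeal P I = allF λ x → allF λ y →
  (lookup I x ∧ RawPoset.lt P y x) ⇒ᵇ lookup I y

Ideal : {m : ℕ} → RawPoset m → Set
Ideal P = Σ (Subset (RawPoset.size P)) (λ I → T (isIdeal P I))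

induced : {m : ℕ} → (P : RawPoset m) → Subset (RawPoset.size P) → RawPoset m
induced P I = record
  { size  = count I
  ; label = λ i → RawPoset.label P (emb I i)
  ; lt    = λ i j → RawPoset.lt P (emb I i) (emb I j) }

-- An element ±ω^j s is encoded by (neg , s , j), neg = true meaning the
-- element lies in -S_m.  Order:
--  -s₁ < s₁ < -ωs₁ < ωs₁ < ... < -ω^{m-1}s₁ < ω^{m-1}s₁ < -s₂ < ...

record OrdSet : Set₁ where
  field
    Carrier : Set
    _<ˢ_    : Carrier → Carrier → Bool
    _=ˢ_    : Carrier → Carrier → Bool

record SElt (S : OrdSet) (m : ℕ) : Set where
  constructor elt
  field
    neg   : Bool
    base  : OrdSet.Carrier S
    color : Fin m

module _ {S : OrdSet} {m : ℕ} where
  open OrdSet S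

  _<±_ : SElt S m → SElt S m → Bool
  elt a s j <± elt b t k =
    (s <ˢ t) ∨ ((s =ˢ t) ∧ (ltFin j k ∨ (eqFin j k ∧ (a ∧ not b))))

  _=±_ : SElt S m → SElt S m → Bool
  elt a s j =± elt b t k = (s =ˢ t) ∧ (eqFin j k ∧ (if a then b else not b))

  _≤⁺_ : SElt S m → SElt S m → Bool
  x ≤⁺ y = (x <± y) ∨ ((x =± y) ∧ not (SElt.neg y))

  _≤⁻_ : SElt S m → SElt S m → Bool
  x ≤⁻ y = (x <± y) ∨ ((x =± y) ∧ SElt.neg x)

isEnriched : {m : ℕ} (S : OrdSet) (P : RawPoset m) →
             Vec (SElt S m) (RawPoset.size P) → Bool
isEnriched S P f = allF λ i → eqFin (SElt.color (lookup f i)) (proj₂ (label i))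
    ∧ allF λ j →
      ((lt i j ∧ (label i <Pm label j)) ⇒ᵇ (lookup f i ≤⁺ lookup f j))
    ∧ ((lt i j ∧ (label j <Pm label i)) ⇒ᵇ (lookup f i ≤⁻ lookup f j))
  where open RawPoset P

Enriched : {m : ℕ} → RawPoset m → OrdSet → Set
Enriched {m} P S = Σ (Vec (SElt S m) (RawPoset.size P)) (λ f → T (isEnriched S P f))

-- {1 < 2 < ...}  (n encodes n+1)
ℕOrd : OrdSet
ℕOrd = record { Carrier = ℕ ; _<ˢ_ = _<ᵇ_ ; _=ˢ_ = _≡ᵇ_ }

-- {1' < 2' < ...}  (again encoded by ℕ; a separate copy)
ℕ'Ord : OrdSet
ℕ'Ord = record { Carrier = ℕ ; _<ˢ_ = _<ᵇ_ ; _=ˢ_ = _≡ᵇ_ }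

-- {1 < 2 < ... < 1' < 2' < ...}: inj₁ n = n+1, inj₂ n = (n+1)'
_<⊎_ : ℕ ⊎ ℕ → ℕ ⊎ ℕ → Bool
inj₁ a <⊎ inj₁ b = a <ᵇ b
inj₁ a <⊎ inj₂ b = true
inj₂ a <⊎ inj₁ b = false
inj₂ a <⊎ inj₂ b = a <ᵇ b

_=⊎_ : ℕ ⊎ ℕ → ℕ ⊎ ℕ → Bool
inj₁ a =⊎ inj₁ b = a ≡ᵇ b
inj₁ a =⊎ inj₂ b = false
inj₂ a =⊎ inj₁ b = false
inj₂ a =⊎ inj₂ b = a ≡ᵇ b

ℕ+ℕ'Ord : OrdSet
ℕ+ℕ'Ord = record { Carrier = ℕ ⊎ ℕ ; _<ˢ_ = _<⊎_ ; _=ˢ_ = _=⊎_ }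

-- An enriched P-partition f into ℙ^± + (ℙ^±)′ splits P into the set I of elements sent to
-- the unprimed copy and its complement, and f into its restrictions to I and P ∖ I, which are
-- enriched.  Every unprimed value lies strictly below every primed one, and P-related elements
-- (having distinct labels) receive weakly increasing values, so an element below one of I lies
-- in I: I is an order ideal.  Conversely, gluing enriched partitions of an ideal I and of P ∖ I
-- gives an enriched partition of P: a pair with the smaller element in I is correctly ordered
-- automatically, and no element of P ∖ I lies below an element of I.

module Submission where

open import Defs
open import Data.Bool using (Bool; true; false; _∧_; T)
open import Data.Bool.Properties using (T-∧; T-∨; T-irrelevant)
open import Data.Empty using (⊥-elim)
open import Data.Fin using (Fin; zero; suc)
open import Data.Nat using (ℕ; zero; suc; _≤_)
open import Data.Nat.Properties using (<-cmp; <⇒<ᵇ)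
open import Data.Product using (Σ; _×_; _,_; proj₁; proj₂)
open import Data.Product.Properties using (Σ-≡,≡→≡)
open import Data.Sum using (_⊎_; inj₁; inj₂; [_,_])
open import Data.Unit using (tt)
open import Data.Vec using (Vec; []; _∷_; lookup; map)
open import Data.Vec.Properties using (lookup-map; map-∘; map-id; map-cong)
open import Function using (_∘_; Equivalence)
open import Function.Bundles using (_⤖_; mk↔ₛ′)
open import Function.Properties.Inverse using (↔⇒⤖)
open import Relation.Binary using (tri<; tri≈; tri>)
open import Relation.Binary.PropositionalEquality
  using (_≡_; refl; cong; sym; trans; subst; subst₂; module ≡-Reasoning)
open import Relation.Nullary using (¬_)

open Equivalence using (to; from)

∧-intro : ∀ {a b} → T a → T b → T (a ∧ b)
∧-intro ta tb = from T-∧ (ta , tb)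

⇒ᵇ-intro : ∀ {a b} → (T a → T b) → T (a ⇒ᵇ b)
⇒ᵇ-intro {false} _ = tt
⇒ᵇ-intro {true}  k = k tt

⇒ᵇ-elim : ∀ {a b} → T (a ⇒ᵇ b) → T a → T b
⇒ᵇ-elim {true} t _ = t

allF-intro : ∀ {k} (p : Fin k → Bool) → (∀ i → T (p i)) → T (allF p)
allF-intro {zero}  p h = tt
allF-intro {suc k} p h = ∧-intro (h zero) (allF-intro (p ∘ suc) (h ∘ suc))

allF-elim : ∀ {k} (p : Fin k → Bool) → T (allF p) → ∀ i → T (p i)
allF-elim {suc k} p t zero    = proj₁ (to T-∧ t)
allF-elim {suc k} p t (suc i) = allF-elim (p ∘ suc) (proj₂ (to T-∧ t)) i

module _ {m : ℕ} (S : OrdSet) (P : RawPoset m) (f : Vec (SElt S m) (RawPoset.size P)) where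
  open RawPoset P

  colorMatches : Fin size → Bool
  colorMatches i = eqFin (SElt.color (lookup f i)) (proj₂ (label i))

  orderRespected : Fin size → Fin size → Bool
  orderRespected i j =
      ((lt i j ∧ (label i <Pm label j)) ⇒ᵇ (lookup f i ≤⁺ lookup f j))
    ∧ ((lt i j ∧ (label j <Pm label i)) ⇒ᵇ (lookup f i ≤⁻ lookup f j))

  isEnriched-intro : (∀ i → T (colorMatches i)) → (∀ i j → T (orderRespected i j)) →
                     T (isEnriched S P f)
  isEnriched-intro col ord =
    allF-intro _ λ i → ∧-intro (col i) (allF-intro _ (ord i))

  isEnriched⇒colorMatches : T (isEnriched S P f) → ∀ i → T (colorMatches i)
  isEnriched⇒colorMatches t i = proj₁ (to T-∧ (allF-elim _ t i))

  isEnriched⇒orderRespected : T (isEnriched S P f) → ∀ i j → T (orderRespected i j)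
  isEnriched⇒orderRespected t i = allF-elim _ (proj₂ (to T-∧ (allF-elim _ t i)))

  orderRespected⇒≤⁺ : ∀ {i j} → T (orderRespected i j) → T (lt i j) → T (label i <Pm label j) →
                      T (lookup f i ≤⁺ lookup f j)
  orderRespected⇒≤⁺ {i} {j} t i<j ℓi<ℓj =
    ⇒ᵇ-elim (proj₁ (to (T-∧ {(lt i j ∧ (label i <Pm label j)) ⇒ᵇ _}) t)) (∧-intro i<j ℓi<ℓj)

  orderRespected⇒≤⁻ : ∀ {i j} → T (orderRespected i j) → T (lt i j) → T (label j <Pm label i) →
                      T (lookup f i ≤⁻ lookup f j)
  orderRespected⇒≤⁻ {i} {j} t i<j ℓj<ℓi =
    ⇒ᵇ-elim (proj₂ (to (T-∧ {(lt i j ∧ (label i <Pm label j)) ⇒ᵇ _}) t)) (∧-intro i<j ℓj<ℓi)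

  ≤⁺×≤⁻⇒orderRespected : ∀ i j → T (lookup f i ≤⁺ lookup f j) → T (lookup f i ≤⁻ lookup f j) →
                           T (orderRespected i j)
  ≤⁺×≤⁻⇒orderRespected i j le⁺ le⁻ =
    ∧-intro (⇒ᵇ-intro {lt i j ∧ (label i <Pm label j)} λ _ → le⁺)
            (⇒ᵇ-intro {lt i j ∧ (label j <Pm label i)} λ _ → le⁻)

  unrelated⇒orderRespected : ∀ i j → ¬ T (lt i j) → T (orderRespected i j)
  unrelated⇒orderRespected i j i≮j =
    ∧-intro (⇒ᵇ-intro {lt i j ∧ (label i <Pm label j)} (⊥-elim ∘ i≮j ∘ proj₁ ∘ to T-∧))
            (⇒ᵇ-intro {lt i j ∧ (label j <Pm label i)} (⊥-elim ∘ i≮j ∘ proj₁ ∘ to T-∧))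

module _ {m : ℕ} {S : OrdSet} (Q : ColoredPoset m) (f : Vec (SElt S m) (ColoredPoset.size Q)) where
  open ColoredPoset Q

  orderRespected-monotone : ∀ {i j} → T (orderRespected S (raw Q) f i j) → T (lt i j) →
                            T (lookup f i ≤⁺ lookup f j) ⊎ T (lookup f i ≤⁻ lookup f j)
  orderRespected-monotone {i} {j} respected i<j with <-cmp (proj₁ (label i)) (proj₁ (label j))
  ... | tri< s<t _ _ = inj₁ (orderRespected⇒≤⁺ S (raw Q) f respected i<j (from T-∨ (inj₁ (<⇒<ᵇ s<t))))
  ... | tri≈ _ s≡t _ = ⊥-elim (irrefl j (subst (λ k → T (lt k j)) (distinct i j s≡t) i<j))
  ... | tri> _ _ t<s = inj₂ (orderRespected⇒≤⁻ S (raw Q) f respected i<j (from T-∨ (inj₁ (<⇒<ᵇ t<s))))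

emb-member : ∀ {n} (I : Subset n) i → lookup I (emb I i) ≡ true
emb-member (true ∷ I)  zero    = refl
emb-member (true ∷ I)  (suc i) = emb-member I i
emb-member (false ∷ I) i       = emb-member I i

emb-complement-nonmember : ∀ {n} (I : Subset n) i → lookup I (emb (complement I) i) ≡ false
emb-complement-nonmember (true ∷ I)  i       = emb-complement-nonmember I i
emb-complement-nonmember (false ∷ I) zero    = refl
emb-complement-nonmember (false ∷ I) (suc i) = emb-complement-nonmember I i

data EmbImage {n} (I : Subset n) : Fin n → Set where
  inSubset     : ∀ i → EmbImage I (emb I i)
  inComplement : ∀ i → EmbImage I (emb (complement I) i)

embImage : ∀ {n} (I : Subset n) x → EmbImage I x
embImage (true ∷ I)  zero = inSubset zero
embImage (false ∷ I) zero = inComplement zero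
embImage (true ∷ I)  (suc x) with embImage I x
... | inSubset i     = inSubset (suc i)
... | inComplement i = inComplement i
embImage (false ∷ I) (suc x) with embImage I x
... | inSubset i     = inSubset i
... | inComplement i = inComplement (suc i)

module _ {m : ℕ} (P : RawPoset m) (I : Subset (RawPoset.size P)) where
  open RawPoset P

  isIdeal-intro : (∀ x y → T (lookup I x) → T (lt y x) → T (lookup I y)) → T (isIdeal P I)
  isIdeal-intro down = allF-intro _ λ x → allF-intro _ λ y →
    ⇒ᵇ-intro {lookup I x ∧ lt y x} λ t → let x∈I , y<x = to T-∧ t in down x y x∈I y<x

  isIdeal-elim : T (isIdeal P I) → ∀ {x y} → T (lookup I x) → T (lt y x) → T (lookup I y)
  isIdeal-elim t {x} {y} x∈I y<x = ⇒ᵇ-elim (allF-elim _ (allF-elim _ t x) y) (∧-intro x∈I y<x)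

module _ {A B : Set} where

  Interleaving : ℕ → Set
  Interleaving n = Σ (Subset n) λ I → Vec A (count I) × Vec B (count (complement I))

  interleave : ∀ {n} (I : Subset n) → Vec A (count I) → Vec B (count (complement I)) → Vec (A ⊎ B) n
  interleave []          []      []      = []
  interleave (true ∷ I)  (x ∷ g) h       = inj₁ x ∷ interleave I g h
  interleave (false ∷ I) g       (y ∷ h) = inj₂ y ∷ interleave I g h

  deinterleave : ∀ {n} → Vec (A ⊎ B) n → Interleaving n
  deinterleave []           = [] , [] , []
  deinterleave (inj₁ x ∷ v) = let I , g , h = deinterleave v in true ∷ I , x ∷ g , h
  deinterleave (inj₂ y ∷ v) = let I , g , h = deinterleave v in false ∷ I , g , y ∷ h

  interleave-deinterleave : ∀ {n} (v : Vec (A ⊎ B) n) →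
    let I , g , h = deinterleave v in interleave I g h ≡ v
  interleave-deinterleave []           = refl
  interleave-deinterleave (inj₁ x ∷ v) = cong (inj₁ x ∷_) (interleave-deinterleave v)
  interleave-deinterleave (inj₂ y ∷ v) = cong (inj₂ y ∷_) (interleave-deinterleave v)

  deinterleave-interleave : ∀ {n} (I : Subset n) g h → deinterleave (interleave I g h) ≡ (I , g , h)
  deinterleave-interleave []          []      []      = refl
  deinterleave-interleave (true ∷ I)  (x ∷ g) h       =
    cong (λ (I , g , h) → true ∷ I , x ∷ g , h) (deinterleave-interleave I g h)
  deinterleave-interleave (false ∷ I) g       (y ∷ h) =
    cong (λ (I , g , h) → false ∷ I , g , y ∷ h) (deinterleave-interleave I g h)

  lookup-interleave-subset : ∀ {n} (I : Subset n) g h i →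
    lookup (interleave I g h) (emb I i) ≡ inj₁ (lookup g i)
  lookup-interleave-subset (true ∷ I)  (x ∷ g) h       zero    = refl
  lookup-interleave-subset (true ∷ I)  (x ∷ g) h       (suc i) = lookup-interleave-subset I g h i
  lookup-interleave-subset (false ∷ I) g       (y ∷ h) i       = lookup-interleave-subset I g h i

  lookup-interleave-complement : ∀ {n} (I : Subset n) g h i →
    lookup (interleave I g h) (emb (complement I) i) ≡ inj₂ (lookup h i)
  lookup-interleave-complement (true ∷ I)  (x ∷ g) h       i       = lookup-interleave-complement I g h i
  lookup-interleave-complement (false ∷ I) g       (y ∷ h) zero    = refl
  lookup-interleave-complement (false ∷ I) g       (y ∷ h) (suc i) = lookup-interleave-complement I g h i

record ColoredEmbedding (S S′ : OrdSet) (m : ℕ) : Set where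
  field
    ι       : SElt S m → SElt S′ m
    color-ι : ∀ x → SElt.color (ι x) ≡ SElt.color x
    ≤⁺-ι    : ∀ x y → (ι x ≤⁺ ι y) ≡ (x ≤⁺ y)
    ≤⁻-ι    : ∀ x y → (ι x ≤⁻ ι y) ≡ (x ≤⁻ y)

module _ {m : ℕ} {S S′ : OrdSet} (e : ColoredEmbedding S S′ m) (P : RawPoset m)
         (I : Subset (RawPoset.size P)) (g : Vec (SElt S m) (count I))
         (F : Vec (SElt S′ m) (RawPoset.size P))
         (F∘emb : ∀ i → lookup F (emb I i) ≡ ColoredEmbedding.ι e (lookup g i)) where
  open ColoredEmbedding e

  colorMatches-emb : ∀ i → colorMatches S′ P F (emb I i) ≡ colorMatches S (induced P I) g i
  colorMatches-emb i rewrite F∘emb i | color-ι (lookup g i) = refl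

  orderRespected-emb : ∀ i j →
    orderRespected S′ P F (emb I i) (emb I j) ≡ orderRespected S (induced P I) g i j
  orderRespected-emb i j
    rewrite F∘emb i | F∘emb j | ≤⁺-ι (lookup g i) (lookup g j) | ≤⁻-ι (lookup g i) (lookup g j) = refl

  isEnriched-restrict : T (isEnriched S′ P F) → T (isEnriched S (induced P I) g)
  isEnriched-restrict t = isEnriched-intro S (induced P I) g
    (λ i → subst T (colorMatches-emb i) (isEnriched⇒colorMatches S′ P F t (emb I i)))
    (λ i j → subst T (orderRespected-emb i j) (isEnriched⇒orderRespected S′ P F t (emb I i) (emb I j)))

module _ {m : ℕ} where

  left : SElt ℕOrd m → SElt ℕ+ℕ'Ord m
  left (elt a s j) = elt a (inj₁ s) j

  right : SElt ℕ'Ord m → SElt ℕ+ℕ'Ord m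
  right (elt a s j) = elt a (inj₂ s) j

  join : SElt ℕOrd m ⊎ SElt ℕ'Ord m → SElt ℕ+ℕ'Ord m
  join = [ left , right ]

  split : SElt ℕ+ℕ'Ord m → SElt ℕOrd m ⊎ SElt ℕ'Ord m
  split (elt a (inj₁ s) j) = inj₁ (elt a s j)
  split (elt a (inj₂ s) j) = inj₂ (elt a s j)

  split-join : ∀ x → split (join x) ≡ x
  split-join (inj₁ (elt a s j)) = refl
  split-join (inj₂ (elt a s j)) = refl

  join-split : ∀ u → join (split u) ≡ u
  join-split (elt a (inj₁ s) j) = refl
  join-split (elt a (inj₂ s) j) = refl

  leftEmbedding : ColoredEmbedding ℕOrd ℕ+ℕ'Ord m
  leftEmbedding = record
    { ι       = left
    ; color-ι = λ { (elt a s j) → refl }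
    ; ≤⁺-ι    = λ { (elt a s j) (elt b t k) → refl }
    ; ≤⁻-ι    = λ { (elt a s j) (elt b t k) → refl }
    }

  rightEmbedding : ColoredEmbedding ℕ'Ord ℕ+ℕ'Ord m
  rightEmbedding = record
    { ι       = right
    ; color-ι = λ { (elt a s j) → refl }
    ; ≤⁺-ι    = λ { (elt a s j) (elt b t k) → refl }
    ; ≤⁻-ι    = λ { (elt a s j) (elt b t k) → refl }
    }

  left≤⁺right : ∀ x y → T (left x ≤⁺ right y)
  left≤⁺right (elt a s j) (elt b t k) = tt

  left≤⁻right : ∀ x y → T (left x ≤⁻ right y)
  left≤⁻right (elt a s j) (elt b t k) = tt

  right≰left : ∀ y x → ¬ (T (right y ≤⁺ left x) ⊎ T (right y ≤⁻ left x))
  right≰left (elt b t k) (elt a s j) (inj₁ ())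
  right≰left (elt b t k) (elt a s j) (inj₂ ())

  recombine : ∀ {n} (I : Subset n) → Vec (SElt ℕOrd m) (count I) → Vec (SElt ℕ'Ord m) (count (complement I)) →
              Vec (SElt ℕ+ℕ'Ord m) n
  recombine I g h = map join (interleave I g h)

  decompose : ∀ {n} → Vec (SElt ℕ+ℕ'Ord m) n → Interleaving n
  decompose f = deinterleave (map split f)

  recombine-decompose : ∀ {n} (f : Vec (SElt ℕ+ℕ'Ord m) n) → let I , g , h = decompose f in recombine I g h ≡ f
  recombine-decompose f = begin
    map join (interleave _ _ _)  ≡⟨ cong (map join) (interleave-deinterleave (map split f)) ⟩
    map join (map split f)       ≡⟨ map-∘ join split f ⟨
    map (join ∘ split) f         ≡⟨ map-cong join-split f ⟩
    map (λ u → u) f              ≡⟨ map-id f ⟩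
    f                            ∎
    where open ≡-Reasoning

  decompose-recombine : ∀ {n} (I : Subset n) g h → decompose (recombine I g h) ≡ (I , g , h)
  decompose-recombine I g h = begin
    deinterleave (map split (map join v))  ≡⟨ cong deinterleave (map-∘ split join v) ⟨
    deinterleave (map (split ∘ join) v)    ≡⟨ cong deinterleave (map-cong split-join v) ⟩
    deinterleave (map (λ x → x) v)         ≡⟨ cong deinterleave (map-id v) ⟩
    deinterleave v                         ≡⟨ deinterleave-interleave I g h ⟩
    (I , g , h)                            ∎
    where open ≡-Reasoning
          v = interleave I g h

  lookup-recombine-subset : ∀ {n} (I : Subset n) g h i → lookup (recombine I g h) (emb I i) ≡ left (lookup g i)
  lookup-recombine-subset I g h i =
    trans (lookup-map (emb I i) join (interleave I g h)) (cong join (lookup-interleave-subset I g h i))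

  lookup-recombine-complement : ∀ {n} (I : Subset n) g h i →
    lookup (recombine I g h) (emb (complement I) i) ≡ right (lookup h i)
  lookup-recombine-complement I g h i =
    trans (lookup-map (emb (complement I) i) join (interleave I g h)) (cong join (lookup-interleave-complement I g h i))

module _ {m : ℕ} (P : RawPoset m) (I : Subset (RawPoset.size P))
         (g : Vec (SElt ℕOrd m) (count I)) (h : Vec (SElt ℕ'Ord m) (count (complement I))) where

  private
    F = recombine I g h

  isEnriched-recombine⇒left : T (isEnriched ℕ+ℕ'Ord P F) → T (isEnriched ℕOrd (induced P I) g)
  isEnriched-recombine⇒left = isEnriched-restrict leftEmbedding P I g F (lookup-recombine-subset I g h)

  isEnriched-recombine⇒right : T (isEnriched ℕ+ℕ'Ord P F) → T (isEnriched ℕ'Ord (induced P (complement I)) h)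
  isEnriched-recombine⇒right =
    isEnriched-restrict rightEmbedding P (complement I) h F (lookup-recombine-complement I g h)

  isEnriched-recombine : T (isIdeal P I) → T (isEnriched ℕOrd (induced P I) g) →
                         T (isEnriched ℕ'Ord (induced P (complement I)) h) → T (isEnriched ℕ+ℕ'Ord P F)
  isEnriched-recombine ideal tg th = isEnriched-intro ℕ+ℕ'Ord P F color order
    where
    color : ∀ x → T (colorMatches ℕ+ℕ'Ord P F x)
    color x with embImage I x
    ... | inSubset i = subst T (sym (colorMatches-emb leftEmbedding P I g F (lookup-recombine-subset I g h) i))
                         (isEnriched⇒colorMatches ℕOrd (induced P I) g tg i)
    ... | inComplement i =
      subst T (sym (colorMatches-emb rightEmbedding P (complement I) h F (lookup-recombine-complement I g h) i))
        (isEnriched⇒colorMatches ℕ'Ord (induced P (complement I)) h th i)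

    order : ∀ x y → T (orderRespected ℕ+ℕ'Ord P F x y)
    order x y with embImage I x | embImage I y
    ... | inSubset i | inSubset j =
      subst T (sym (orderRespected-emb leftEmbedding P I g F (lookup-recombine-subset I g h) i j))
        (isEnriched⇒orderRespected ℕOrd (induced P I) g tg i j)
    ... | inComplement i | inComplement j =
      subst T (sym (orderRespected-emb rightEmbedding P (complement I) h F (lookup-recombine-complement I g h) i j))
        (isEnriched⇒orderRespected ℕ'Ord (induced P (complement I)) h th i j)
    ... | inSubset i | inComplement j = ≤⁺×≤⁻⇒orderRespected ℕ+ℕ'Ord P F _ _
      (subst₂ (λ u v → T (u ≤⁺ v)) Fi Fj (left≤⁺right (lookup g i) (lookup h j)))
      (subst₂ (λ u v → T (u ≤⁻ v)) Fi Fj (left≤⁻right (lookup g i) (lookup h j)))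
      where Fi = sym (lookup-recombine-subset I g h i)
            Fj = sym (lookup-recombine-complement I g h j)
    ... | inComplement i | inSubset j = unrelated⇒orderRespected ℕ+ℕ'Ord P F _ _ λ x<y →
      subst T (emb-complement-nonmember I i)
        (isIdeal-elim P I ideal (subst T (sym (emb-member I j)) tt) x<y)

module _ {m : ℕ} (Q : ColoredPoset m) (I : Subset (ColoredPoset.size Q))
         (g : Vec (SElt ℕOrd m) (count I)) (h : Vec (SElt ℕ'Ord m) (count (complement I))) where
  open ColoredPoset Q

  isEnriched-recombine⇒isIdeal : T (isEnriched ℕ+ℕ'Ord (raw Q) (recombine I g h)) → T (isIdeal (raw Q) I)
  isEnriched-recombine⇒isIdeal t = isIdeal-intro (raw Q) I downClosed
    where
    downClosed : ∀ x y → T (lookup I x) → T (lt y x) → T (lookup I y)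
    downClosed x y x∈I y<x with embImage I x | embImage I y
    ... | inComplement i | _ = ⊥-elim (subst T (emb-complement-nonmember I i) x∈I)
    ... | inSubset i | inSubset j = subst T (sym (emb-member I j)) tt
    ... | inSubset i | inComplement j = ⊥-elim (right≰left (lookup h j) (lookup g i)
      (subst₂ (λ u v → T (u ≤⁺ v) ⊎ T (u ≤⁻ v))
        (lookup-recombine-complement I g h j) (lookup-recombine-subset I g h i)
        (orderRespected-monotone Q F (isEnriched⇒orderRespected ℕ+ℕ'Ord (raw Q) F t _ _) y<x)))
      where F = recombine I g h

module _ {m : ℕ} (P : RawPoset m) where

  Decomposition : Set
  Decomposition = Σ (Ideal P) λ I →
    Enriched (induced P (proj₁ I)) ℕOrd × Enriched (induced P (complement (proj₁ I))) ℕ'Ord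

  decomposition-≡ : ∀ {I I′ : Subset (RawPoset.size P)} {g g′ h h′} →
    _≡_ {A = Interleaving (RawPoset.size P)} (I , g , h) (I′ , g′ , h′) →
    ∀ pI pg ph pI′ pg′ ph′ →
    _≡_ {A = Decomposition} ((I , pI) , (g , pg) , (h , ph)) ((I′ , pI′) , (g′ , pg′) , (h′ , ph′))
  decomposition-≡ refl pI pg ph pI′ pg′ ph′
    rewrite T-irrelevant pI pI′ | T-irrelevant pg pg′ | T-irrelevant ph ph′ = refl

  fromDecomposition : Decomposition → Enriched P ℕ+ℕ'Ord
  fromDecomposition ((I , ideal) , (g , tg) , (h , th)) = recombine I g h , isEnriched-recombine P I g h ideal tg th

toDecomposition : ∀ {m} (Q : ColoredPoset m) → Enriched (raw Q) ℕ+ℕ'Ord → Decomposition (raw Q)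
toDecomposition Q (f , t) =
  let I , g , h = decompose f
      t′ = subst (T ∘ isEnriched ℕ+ℕ'Ord (raw Q)) (sym (recombine-decompose f)) t
  in (I , isEnriched-recombine⇒isIdeal Q I g h t′) ,
     (g , isEnriched-recombine⇒left (raw Q) I g h t′) ,
     (h , isEnriched-recombine⇒right (raw Q) I g h t′)

mainTheorem17 : (m : ℕ) → 1 ≤ m → (P : ColoredPoset m) →
    Enriched (raw P) ℕ+ℕ'Ord
      ⤖ Σ (Ideal (raw P)) (λ I →
          Enriched (induced (raw P) (Σ.proj₁ I)) ℕOrd
            × Enriched (induced (raw P) (complement (Σ.proj₁ I))) ℕ'Ord)
mainTheorem17 m _ Q = ↔⇒⤖ (mk↔ₛ′ (toDecomposition Q) (fromDecomposition (raw Q)) to∘from from∘to)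
  where
  to∘from : ∀ d → toDecomposition Q (fromDecomposition (raw Q) d) ≡ d
  to∘from ((I , ideal) , (g , tg) , (h , th)) =
    decomposition-≡ (raw Q) (decompose-recombine I g h) _ _ _ ideal tg th

  from∘to : ∀ e → fromDecomposition (raw Q) (toDecomposition Q e) ≡ e
  from∘to (f , t) = Σ-≡,≡→≡ (recombine-decompose f , T-irrelevant _ _)
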